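{- Let $d$ be a Motzkin path of length $n$ and let $\pi$ be the permutation in $\mathbf S_n(132,\underline{123})$ with $\Gamma(\pi)=(d,(0,\dots,0))$. Let $t_1,t_2,\dots,t_k$ be the tunnels of $d$, listed in decreasing order of the $x$-coordinate of their leftmost point. Then the decomposition of $\pi$ into ascending runs is $\pi=w_1w_2\cdots w_k$, where $w_i=x_ix'_i$ with $x_i$ equal to the $x$-coordinate of the first point of $t_i$ increased by one and $x'_i$ equal to the $x$-coordinate of the last point of $t_i$ (when $x_i=x'_i$, i.e. $t_i$ is a horizontal step, $w_i$ is the single letter $x_i$).
   Context: A Motzkin path of length $n$ is a word over $\{U,D,H\}$ (steps $(1,1),(1,-1),(1,0)$) from $(0,0)$ to $(n,0)$ never below the $x$-axis. A tunnel of $d$ is a horizontal segment between two lattice points of $d$, lying weakly below $d$, containing exactly two lattice points of $d$ (each horizontal step is a tunnel). $\mathbf S_n(132,\underline{123})$ is the set of $\pi\in\mathbf S_n$ with no subsequence order-isomorphic to $132$ and no three consecutive entries order-isomorphic to $123$. An ascending run is a maximal increasing factor of $\pi$. The map $\Gamma$: for $\pi\in\mathbf S_n$, write $\pi=w_1\cdots w_k$ as the concatenation of its ascending runs. The first and last elements of a run of length $\ge2$ are a head and a tail; the element of a run of length $1$ is a head-tail; other elements are boarders. For each value $i$ put $d_i=H$ if $i$ is a head-tail, $U$ if a head, $D$ if a tail, $\widetilde H$ (second-colored horizontal step) if a boarder; let $l_i=|\{j: s_j<i<t_j,\ t_j\text{ precedes } i\text{ in }\pi\}|$, $s_j,t_j$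 the first and last elements of $w_j$; $\Gamma(\pi)=(d_1\cdots d_n,(l_1,\dots,l_n))$. It is known that $\Gamma$ restricts to a bijection from $\mathbf S_n(132,\underline{123})$ onto $\{(d,(0,\dots,0)): d \text{ a Motzkin path of length } n\}$. -}

module Defs where

open import Data.Nat using (ℕ; zero; suc; _<_; _≤_; _<?_; _≟_)
open import Data.Integer as ℤ using (ℤ)
open import Data.List using (List; []; _∷_; _++_; length; map; filter; upTo; take; foldr; replicate)
open import Data.List.Relation.Binary.Sublist.Propositional using (_⊆_)
open import Data.List.Relation.Binary.Permutation.Propositional using (_↭_)
open import Data.List.Relation.Unary.Linked using (Linked)
open import Data.List.Membership.Propositional using (_∈_)
open import Data.List.Membership.DecPropositional _≟_ using (_∈?_)
open import Data.Product using (Σ; ∃; _×_; _,_; proj₁)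
open import Data.Sum using (_⊎_)
open import Relation.Nullary using (yes; no; ¬_)
open import Relation.Nullary.Decidable using (_×-dec_)
open import Relation.Binary.PropositionalEquality using (_≡_)
open import Function.Bundles using (_⇔_)

-- Permutations of [n] as words (one-line notation), values 1..n

IsPerm : ℕ → List ℕ → Set
IsPerm n π = π ↭ map suc (upTo n)

Contains132 : List ℕ → Set
Contains132 π = Σ ℕ λ a → Σ ℕ λ b → Σ ℕ λ c →
  ((a ∷ b ∷ c ∷ []) ⊆ π) × a < c × c < b

ContainsConsec123 : List ℕ → Set
ContainsConsec123 π = Σ (List ℕ) λ xs → Σ (List ℕ) λ ys →
  Σ ℕ λ a → Σ ℕ λ b → Σ ℕ λ c →
  (π ≡ xs ++ (a ∷ b ∷ c ∷ ys)) × a < b × b < c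

InS132-123 : ℕ → List ℕ → Set
InS132-123 n π = IsPerm n π × ¬ Contains132 π × ¬ ContainsConsec123 π

private
  consHead : ℕ → List (List ℕ) → List (List ℕ)
  consHead x []       = (x ∷ []) ∷ []
  consHead x (r ∷ rs) = (x ∷ r) ∷ rs

runsFrom : ℕ → List ℕ → List (List ℕ)
runsFrom x []       = (x ∷ []) ∷ []
runsFrom x (y ∷ zs) with x <? y
... | yes _ = consHead x (runsFrom y zs)
... | no  _ = (x ∷ []) ∷ runsFrom y zs

runs : List ℕ → List (List ℕ)
runs []       = []
runs (x ∷ xs) = runsFrom x xs

-- first and last element of a (nonempty) run; default 0 never used
first : List ℕ → ℕ
first []      = 0
first (x ∷ _) = x

lastOf : List ℕ → ℕ
lastOf []           = 0
lastOf (x ∷ [])     = x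
lastOf (_ ∷ y ∷ ys) = lastOf (y ∷ ys)

indexOf : ℕ → List ℕ → ℕ
indexOf x []       = 0
indexOf x (y ∷ ys) with x ≟ y
... | yes _ = 0
... | no  _ = suc (indexOf x ys)

-- Steps: U, D, H and the second-coloured horizontal step H̃ (Ht)

data Step : Set where
  U D H Ht : Step

runOf : List (List ℕ) → ℕ → List ℕ
runOf []       i = []
runOf (w ∷ ws) i with i ∈? w
... | yes _ = w
... | no  _ = runOf ws i

stepIn : List ℕ → ℕ → Step
stepIn []           i = H
stepIn (x ∷ [])     i = H
stepIn (x ∷ y ∷ ys) i with i ≟ x
... | yes _ = U
... | no  _ with i ≟ lastOf (y ∷ ys)
...   | yes _ = D
...   | no  _ = Ht

-- l_i = #{ j : s_j < i < t_j, t_j precedes i in π }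
lval : List ℕ → ℕ → ℕ
lval π i = length (filter
  (λ w → (first w <? i) ×-dec ((i <? lastOf w) ×-dec (indexOf (lastOf w) π <? indexOf i π)))
  (runs π))

Γ : List ℕ → List Step × List ℕ
Γ π = map (λ i → stepIn (runOf (runs π) i) i) vals , map (lval π) vals
  where vals = map suc (upTo (length π))

data MotzkinFrom : ℕ → List Step → Set where
  end  : MotzkinFrom 0 []
  up   : ∀ {h d} → MotzkinFrom (suc h) d → MotzkinFrom h (U ∷ d)
  down : ∀ {h d} → MotzkinFrom h d → MotzkinFrom (suc h) (D ∷ d)
  hor  : ∀ {h d} → MotzkinFrom h d → MotzkinFrom h (H ∷ d)

IsMotzkin : ℕ → List Step → Set
IsMotzkin n d = MotzkinFrom 0 d × length d ≡ n

stepVal : Step → ℤ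
stepVal U  = ℤ.+ 1
stepVal D  = ℤ.- (ℤ.+ 1)
stepVal H  = ℤ.+ 0
stepVal Ht = ℤ.+ 0

height : List Step → ℕ → ℤ
height d j = foldr (λ s acc → stepVal s ℤ.+ acc) (ℤ.+ 0) (take j d)

-- A tunnel of d, given by the x-coordinates (a , b) of its endpoints:
-- the horizontal segment from (a, h_a) to (b, h_b), with h_a = h_b, lies
-- weakly below d and contains exactly two lattice points of d.
IsTunnel : List Step → ℕ × ℕ → Set
IsTunnel d (a , b) =
  a < b × b ≤ length d × height d a ≡ height d b ×
  (∀ j → a ≤ j → j ≤ b → height d a ℤ.≤ height d j) ×
  (∀ j → a ≤ j → j ≤ b → height d j ≡ height d a → j ≡ a ⊎ j ≡ b)

TunnelsDecreasing : List Step → List (ℕ × ℕ) → Set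
TunnelsDecreasing d ts =
  (∀ t → (t ∈ ts) ⇔ IsTunnel d t) ×
  Linked (λ s t → proj₁ t < proj₁ s) ts

tunnelWord : ℕ × ℕ → List ℕ
tunnelWord (a , b) with suc a ≟ b
... | yes _ = b ∷ []
... | no  _ = suc a ∷ b ∷ []

module Submission where

-- Proposition 5.1.  Only the first component d of Γ(π) matters: d is the step word of π, with letter i equal to
-- H, U or D as i is a one-letter run, the head or the tail of a run of π.
--  * General facts: intervals, lists, levels of step words, balanced words; an
--    excursion of d after a steps is a tunnel of d (excursion⇒tunnel), and a
--    tunnel is determined by its left endpoint (tunnel-unique).
--  * Avoiding consecutive 123 makes every run short (a letter or an increasing
--    pair); avoiding 132 then makes the heads of the runs decrease (heads-decrease).
--  * For fixed π (module InClass), values strictly inside a run (s, t) lie in runs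
--    nested inside it (nested), so the steps of such intervals are balanced
--    (balanced-closed): each run spans a tunnel, and each tunnel (a, b) comes from
--    the run containing a + 1.
--  * Runs and tunnel words have strictly decreasing first letters and the same
--    members, hence coincide (decreasing-unique).

open import Defs
open import Data.Nat using (ℕ; zero; suc; _+_; _<_; _≤_; z≤n; s≤s; _<?_; _≟_)
open import Data.Nat.Properties
open import Data.Nat.Induction using (<-rec)
open import Data.Integer as ℤ using (ℤ; +_; -[1+_])
import Data.Integer.Properties as ℤP
open import Data.List using (List; []; _∷_; _++_; length; map; concat; take; drop; foldr; replicate; upTo; applyUpTo)
open import Data.List.Properties using (map-++; length-++; length-map; concat-++; ++-assoc; take-map; drop-map; take-take; take-all; length-take; length-drop)
open import Data.List.Relation.Unary.Any using (here; there)
open import Data.List.Relation.Unary.All as All using (All; []; _∷_)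
open import Data.List.Relation.Unary.AllPairs using (AllPairs; []; _∷_)
open import Data.List.Relation.Unary.Linked as Linked using (Linked; []; [-]; _∷_)
open import Data.List.Relation.Unary.Linked.Properties as LinkedP using (Linked⇒AllPairs)
open import Data.List.Relation.Unary.Unique.Propositional using (Unique)
import Data.List.Relation.Unary.Unique.Propositional.Properties as UniqueP
open import Data.List.Membership.Propositional using (_∈_)
open import Data.List.Membership.Propositional.Properties using (∈-∃++; ∈-++⁻; ∈-++⁺ˡ; ∈-++⁺ʳ; ∈-concat⁻′; ∈-concat⁺′; ∈-map⁺; ∈-map⁻; ∈-upTo⁺; ∈-upTo⁻)
open import Data.List.Membership.DecPropositional _≟_ using (_∈?_)
open import Data.List.Relation.Binary.Sublist.Propositional using (_⊆_; ⊆-refl; ⊆-trans; _∷_; minimum; from∈)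
open import Data.List.Relation.Binary.Sublist.Propositional.Properties using (++⁺ˡ) renaming (++⁺ to ⊆-++⁺)
open import Data.List.Relation.Binary.Permutation.Propositional using (_↭_; ↭-sym; ↭⇒↭ₛ)
open import Data.List.Relation.Binary.Permutation.Propositional.Properties using (∈-resp-↭; ↭-length)
import Data.List.Relation.Binary.Permutation.Setoid.Properties as PermutationS
open import Data.Product using (∃-syntax; _×_; _,_; proj₁; proj₂)
open import Data.Sum using (_⊎_; inj₁; inj₂)
open import Data.Empty using (⊥; ⊥-elim)
open import Function using (_∘_)
open import Function.Bundles using (Equivalence)
open import Relation.Nullary using (yes; no; ¬_; contradiction)
open import Relation.Binary.PropositionalEquality
open import Relation.Binary.PropositionalEquality.Properties using (setoid)

interval : ℕ → ℕ → List ℕ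
interval u zero    = []
interval u (suc k) = u ∷ interval (suc u) k

length-interval : ∀ u k → length (interval u k) ≡ k
length-interval u zero    = refl
length-interval u (suc k) = cong suc (length-interval (suc u) k)

map-suc-applyUpTo : ∀ (f : ℕ → ℕ) u k → (∀ i → f i ≡ u + i) →
  map suc (applyUpTo f k) ≡ interval (suc u) k
map-suc-applyUpTo f u zero    f≗ = refl
map-suc-applyUpTo f u (suc k) f≗ =
  cong₂ _∷_ (cong suc (trans (f≗ 0) (+-identityʳ u)))
            (map-suc-applyUpTo (f ∘ suc) (suc u) k (λ i → trans (f≗ (suc i)) (+-suc u i)))

values-interval : ∀ n → map suc (upTo n) ≡ interval 1 n
values-interval n = map-suc-applyUpTo (λ i → i) 0 n (λ i → refl)

interval-++ : ∀ u k l → interval u (k + l) ≡ interval u k ++ interval (u + k) l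
interval-++ u zero    l = cong (λ v → interval v l) (sym (+-identityʳ u))
interval-++ u (suc k) l = cong (u ∷_) (trans (interval-++ (suc u) k l)
  (cong (λ v → interval (suc u) k ++ interval v l) (sym (+-suc u k))))

take-interval : ∀ u {k l} → l ≤ k → take l (interval u k) ≡ interval u l
take-interval u {k}     {zero}  _        = refl
take-interval u {suc k} {suc l} (s≤s le) = cong (u ∷_) (take-interval (suc u) le)

window-interval : ∀ u k a L → a + L ≤ k → take L (drop a (interval u k)) ≡ interval (u + a) L
window-interval u k zero L le rewrite +-identityʳ u = take-interval u le
window-interval u (suc k) (suc a) L (s≤s le) rewrite +-suc u a = window-interval (suc u) k a L le

take-+ : ∀ {A : Set} a p (xs : List A) → take (a + p) xs ≡ take a xs ++ take p (drop a xs)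
take-+ zero    p xs       = refl
take-+ (suc a) zero    [] = refl
take-+ (suc a) (suc p) [] = refl
take-+ (suc a) p (x ∷ xs) = cong (x ∷_) (take-+ a p xs)

take-++-≤ : ∀ {A : Set} p (xs ys : List A) → p ≤ length xs → take p (xs ++ ys) ≡ take p xs
take-++-≤ zero    xs       ys le       = refl
take-++-≤ (suc p) (x ∷ xs) ys (s≤s le) = cong (x ∷_) (take-++-≤ p xs ys le)

take-++-+ : ∀ {A : Set} (xs ys : List A) q → take (length xs + q) (xs ++ ys) ≡ xs ++ take q ys
take-++-+ []       ys q = refl
take-++-+ (x ∷ xs) ys q = cong (x ∷_) (take-++-+ xs ys q)

≤-or-beyond : ∀ q a → q ≤ a ⊎ ∃[ q′ ] q ≡ a + suc q′
≤-or-beyond zero    a       = inj₁ z≤n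
≤-or-beyond (suc q) zero    = inj₂ (q , refl)
≤-or-beyond (suc q) (suc a) with ≤-or-beyond q a
... | inj₁ q≤a       = inj₁ (s≤s q≤a)
... | inj₂ (q′ , eq) = inj₂ (q′ , cong suc eq)

before-last : ∀ {A : Set} {q} (xs : List A) {y} → q < length (xs ++ y ∷ []) → q ≤ length xs
before-last {q = q} xs q< = ≤-pred (subst (q <_) (trans (length-++ xs) (+-comm (length xs) 1)) q<)

-- Arithmetic of an arc (lo, suc lo + m) followed by r further values.
arc-length : ∀ lo m r k → suc (suc lo + m) + r ≡ lo + suc k → k ≡ m + suc r
arc-length lo m r k end≡ = suc-injective (+-cancelˡ-≡ lo _ _ (trans (sym end≡) (sym shape)))
  where
  shape : lo + suc (m + suc r) ≡ suc (suc lo + m) + r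
  shape = trans (+-suc lo (m + suc r)) (cong suc (trans (sym (+-assoc lo m (suc r))) (+-suc (lo + m) r)))

arc-end : ∀ a m → a + suc (m + 1) ≡ suc (suc a) + m
arc-end a m = trans (+-suc a (m + 1)) (cong suc (trans (sym (+-assoc a m 1)) (+-comm (a + m) 1)))

unique-++ʳ : ∀ {A : Set} (xs : List A) {ys} → Unique (xs ++ ys) → Unique ys
unique-++ʳ []       u       = u
unique-++ʳ (x ∷ xs) (_ ∷ u) = unique-++ʳ xs u

unique-apart : ∀ {A : Set} (xs : List A) {ys a b} → Unique (xs ++ ys) → a ∈ xs → b ∈ ys → a ≢ b
unique-apart (x ∷ xs) (x∉ ∷ _) (here refl) b∈ys = All.lookup x∉ (∈-++⁺ʳ xs b∈ys)
unique-apart (x ∷ xs) (_ ∷ u)  (there a∈xs) b∈ys = unique-apart xs u a∈xs b∈ys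

same-block : ∀ {A : Set} (R : List (List A)) → Unique (concat R) →
  ∀ {w w′ z} → w ∈ R → w′ ∈ R → z ∈ w → z ∈ w′ → w ≡ w′
same-block (v ∷ R) u (here refl) (here refl)  _   _    = refl
same-block (v ∷ R) u (here refl) (there w′∈R) z∈w z∈w′ = ⊥-elim (unique-apart v u z∈w (∈-concat⁺′ z∈w′ w′∈R) refl)
same-block (v ∷ R) u (there w∈R) (here refl)  z∈w z∈w′ = ⊥-elim (unique-apart v u z∈w′ (∈-concat⁺′ z∈w w∈R) refl)
same-block (v ∷ R) u (there w∈R) (there w′∈R) z∈w z∈w′ = same-block R (unique-++ʳ v u) w∈R w′∈R z∈w z∈w′

runOf-block : ∀ R → Unique (concat R) → ∀ {w i} → w ∈ R → i ∈ w → runOf R i ≡ w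
runOf-block (v ∷ R) u {w} {i} w∈R i∈w with i ∈? v
... | yes i∈v = same-block (v ∷ R) u (here refl) w∈R i∈v i∈w
... | no  i∉v with w∈R
...   | here refl  = ⊥-elim (i∉v i∈w)
...   | there w∈R′ = runOf-block R (unique-++ʳ v u) w∈R′ i∈w

block-⊆ : ∀ {A : Set} {w : List A} {Ws l ys} → w ∈ Ws → l ⊆ ys → w ++ l ⊆ concat Ws ++ ys
block-⊆ {w = w} {_ ∷ Ws} {ys = ys} (here refl) l⊆ys =
  subst (w ++ _ ⊆_) (sym (++-assoc w (concat Ws) ys)) (⊆-++⁺ ⊆-refl (++⁺ˡ (concat Ws) l⊆ys))
block-⊆ {Ws = v ∷ Ws} {ys = ys} (there w∈Ws) l⊆ys =
  subst (_ ⊆_) (sym (++-assoc v (concat Ws) ys)) (++⁺ˡ v (block-⊆ w∈Ws l⊆ys))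

AllPairs-before : ∀ {A : Set} {Rel : A → A → Set} (As : List A) {v Bs z} →
  AllPairs Rel (As ++ v ∷ Bs) → z ∈ As → Rel z v
AllPairs-before (x ∷ As) (x~ ∷ _)   (here refl) = All.lookup x~ (∈-++⁺ʳ As (here refl))
AllPairs-before (x ∷ As) (_ ∷ rels) (there z∈) = AllPairs-before As rels z∈

decreasing-unique : ∀ {A : Set} (key : A → ℕ) {xs ys : List A} →
  Linked (λ x y → key y < key x) xs → Linked (λ x y → key y < key x) ys →
  (∀ {z} → z ∈ xs → z ∈ ys) → (∀ {z} → z ∈ ys → z ∈ xs) → xs ≡ ys
decreasing-unique {A} key dxs dys = go (Linked⇒AllPairs flip-< dxs) (Linked⇒AllPairs flip-< dys)
  where
  Above : A → A → Set
  Above x y = key y < key x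
  flip-< : ∀ {x y z} → Above x y → Above y z → Above x z
  flip-< xy yz = <-trans yz xy
  -- the common head is not repeated in the tails
  tail-⊆ : ∀ {x xs ys} → All (Above x) xs → (∀ {z} → z ∈ x ∷ xs → z ∈ x ∷ ys) → ∀ {z} → z ∈ xs → z ∈ ys
  tail-⊆ below ⊆ z∈xs with ⊆ (there z∈xs)
  ... | here refl  = ⊥-elim (<-irrefl refl (All.lookup below z∈xs))
  ... | there z∈ys = z∈ys
  go : ∀ {xs ys} → AllPairs Above xs → AllPairs Above ys →
    (∀ {z} → z ∈ xs → z ∈ ys) → (∀ {z} → z ∈ ys → z ∈ xs) → xs ≡ ys
  go [] [] _ _ = refl
  go [] (_ ∷ _) _ ys⊆ = contradiction (ys⊆ (here refl)) λ ()
  go (_ ∷ _) [] xs⊆ _ = contradiction (xs⊆ (here refl)) λ ()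
  go {x ∷ xs} {y ∷ ys} (x> ∷ sxs) (y> ∷ sys) xs⊆ ys⊆ with xs⊆ (here refl) | ys⊆ (here refl)
  ... | here refl | _ = cong (x ∷_) (go sxs sys (tail-⊆ x> xs⊆) (tail-⊆ y> ys⊆))
  ... | there _ | here refl = cong (x ∷_) (go sxs sys (tail-⊆ x> xs⊆) (tail-⊆ y> ys⊆))
  ... | there x∈ys | there y∈xs = ⊥-elim (<-asym (All.lookup y> x∈ys) (All.lookup x> y∈xs))

-- The level of a step word: its net change of height.  By definition,
-- height d j is the level of the first j steps of d.
level : List Step → ℤ
level = foldr (λ s acc → stepVal s ℤ.+ acc) (+ 0)

level-++ : ∀ xs ys → level (xs ++ ys) ≡ level xs ℤ.+ level ys
level-++ []       ys = sym (ℤP.+-identityˡ _)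
level-++ (x ∷ xs) ys =
  trans (cong (λ z → stepVal x ℤ.+ z) (level-++ xs ys)) (sym (ℤP.+-assoc (stepVal x) (level xs) _))

height-window : ∀ d a p → height d (a + p) ≡ height d a ℤ.+ level (take p (drop a d))
height-window d a p = trans (cong level (take-+ a p d)) (level-++ (take a d) _)

rises : ∀ i c → i ℤ.< i ℤ.+ + suc c
rises i c = subst (ℤ._< i ℤ.+ + suc c) (ℤP.+-identityʳ i) (ℤP.+-monoʳ-< i {+ 0} {+ suc c} (ℤ.+<+ (s≤s z≤n)))

falls : ∀ i → i ℤ.+ -[1+ 0 ] ℤ.< i
falls i = subst (i ℤ.+ -[1+ 0 ] ℤ.<_) (ℤP.+-identityʳ i) (ℤP.+-monoʳ-< i { -[1+ 0 ]} {+ 0} ℤ.-<+)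

data Balanced : List Step → Set where
  nil  : Balanced []
  flat : ∀ {xs} → Balanced xs → Balanced (H ∷ xs)
  arch : ∀ {xs ys} → Balanced xs → Balanced ys → Balanced (U ∷ xs ++ D ∷ ys)

level-balanced : ∀ {xs} → Balanced xs → level xs ≡ + 0
level-balanced nil                    = refl
level-balanced (flat b) rewrite level-balanced b = refl
level-balanced (arch {xs} {ys} b₁ b₂)
  rewrite level-++ xs (D ∷ ys) | level-balanced b₁ | level-balanced b₂ = refl

prefix-balanced : ∀ {xs} → Balanced xs → ∀ p → ∃[ c ] level (take p xs) ≡ + c
prefix-balanced nil      zero    = 0 , refl
prefix-balanced nil      (suc p) = 0 , refl
prefix-balanced (flat b) zero    = 0 , refl
prefix-balanced (flat b) (suc p) with prefix-balanced b p
... | c , eq = c , trans (ℤP.+-identityˡ _) eq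
prefix-balanced (arch b₁ b₂) zero = 0 , refl
prefix-balanced (arch {xs} {ys} b₁ b₂) (suc q) with ≤-or-beyond q (length xs)
... | inj₁ q≤ with prefix-balanced b₁ q
...   | c , eq rewrite take-++-≤ q xs (D ∷ ys) q≤ | eq = suc c , refl
prefix-balanced (arch {xs} {ys} b₁ b₂) (suc q) | inj₂ (q′ , refl) with prefix-balanced b₂ q′
... | c , eq rewrite take-++-+ xs (D ∷ ys) (suc q′) | level-++ xs (D ∷ take q′ ys) | level-balanced b₁ | eq
  = c , back-down c
  where
  back-down : ∀ c → + 1 ℤ.+ (+ 0 ℤ.+ (-[1+ 0 ] ℤ.+ + c)) ≡ + c
  back-down zero    = refl
  back-down (suc c) = refl

Excursion : List Step → Set
Excursion E = level E ≡ + 0 × (∀ p → 0 < p → p < length E → ∃[ c ] level (take p E) ≡ + suc c)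

excursion-flat : Excursion (H ∷ [])
excursion-flat = refl , λ { (suc p) _ (s≤s ()) }

excursion-arch : ∀ {X} → Balanced X → Excursion (U ∷ X ++ D ∷ [])
excursion-arch {X} b = returns , above
  where
  returns : level (U ∷ X ++ D ∷ []) ≡ + 0
  returns rewrite level-++ X (D ∷ []) | level-balanced b = refl
  above : ∀ p → 0 < p → p < length (U ∷ X ++ D ∷ []) → ∃[ c ] level (take p (U ∷ X ++ D ∷ [])) ≡ + suc c
  above (suc q) _ (s≤s q<) with prefix-balanced b q
  ... | c , eq rewrite take-++-≤ q X (D ∷ []) (before-last X q<) | eq = c , refl

excursion-window : ∀ d a L → a + L ≤ length d → Excursion (take L (drop a d)) →
  height d (a + L) ≡ height d a ×
  (∀ p → p ≤ L → p ≡ 0 ⊎ p ≡ L ⊎ ∃[ c ] height d (a + p) ≡ height d a ℤ.+ + suc c)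
excursion-window d a L a+L≤ (returns , above) = end-level , profile
  where
  E : List Step
  E = take L (drop a d)
  length-E : length E ≡ L
  length-E = trans (length-take L (drop a d))
               (m≤n⇒m⊓n≡m (subst (L ≤_) (sym (length-drop a d))
                 (m+n≤o⇒m≤o∸n L (subst (_≤ length d) (+-comm a L) a+L≤))))
  height-at : ∀ p → p ≤ L → height d (a + p) ≡ height d a ℤ.+ level (take p E)
  height-at p p≤L = trans (height-window d a p) (cong (λ w → height d a ℤ.+ level w)
                      (sym (trans (take-take p L (drop a d)) (cong (λ m → take m (drop a d)) (m≤n⇒m⊓n≡m p≤L)))))
  end-level : height d (a + L) ≡ height d a
  end-level = trans (height-at L ≤-refl)
                (trans (cong (λ w → height d a ℤ.+ level w) (take-all L E (≤-reflexive length-E)))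
                  (trans (cong (λ z → height d a ℤ.+ z) returns) (ℤP.+-identityʳ _)))
  profile : ∀ p → p ≤ L → p ≡ 0 ⊎ p ≡ L ⊎ ∃[ c ] height d (a + p) ≡ height d a ℤ.+ + suc c
  profile zero _ = inj₁ refl
  profile (suc q) p≤L with suc q ≟ L
  ... | yes p≡L = inj₂ (inj₁ p≡L)
  ... | no  p≢L with above (suc q) (s≤s z≤n) (subst (suc q <_) (sym length-E) (≤∧≢⇒< p≤L p≢L))
  ...   | c , eq = inj₂ (inj₂ (c , trans (height-at (suc q) p≤L) (cong (λ z → height d a ℤ.+ z) eq)))

excursion⇒tunnel : ∀ d a L → 0 < L → a + L ≤ length d → Excursion (take L (drop a d)) → IsTunnel d (a , a + L)
excursion⇒tunnel d a L L>0 a+L≤ excursion with excursion-window d a L a+L≤ excursion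
... | end-level , profile = m<m+n a L>0 , a+L≤ , sym end-level , weakly-above , meets-only-at-ends
  where
  offset : ∀ {j} → a ≤ j → j ≤ a + L → ∃[ p ] a + p ≡ j × p ≤ L
  offset {j} a≤j j≤ with m≤n⇒∃[o]m+o≡n a≤j
  ... | p , refl = p , refl , +-cancelˡ-≤ a p L j≤
  weakly-above : ∀ j → a ≤ j → j ≤ a + L → height d a ℤ.≤ height d j
  weakly-above j a≤j j≤ with offset a≤j j≤
  ... | p , refl , p≤L with profile p p≤L
  ...   | inj₁ refl = ℤP.≤-reflexive (cong (height d) (sym (+-identityʳ a)))
  ...   | inj₂ (inj₁ refl) = ℤP.≤-reflexive (sym end-level)
  ...   | inj₂ (inj₂ (c , eq)) = subst (height d a ℤ.≤_) (sym eq) (ℤP.<⇒≤ (rises (height d a) c))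
  meets-only-at-ends : ∀ j → a ≤ j → j ≤ a + L → height d j ≡ height d a → j ≡ a ⊎ j ≡ a + L
  meets-only-at-ends j a≤j j≤ same with offset a≤j j≤
  ... | p , refl , p≤L with profile p p≤L
  ...   | inj₁ refl = inj₁ (+-identityʳ a)
  ...   | inj₂ (inj₁ refl) = inj₂ refl
  ...   | inj₂ (inj₂ (c , eq)) = ⊥-elim (ℤP.<-irrefl (trans (sym same) eq) (rises (height d a) c))

-- A tunnel is determined by its left endpoint: a second level-return would be interior.
tunnel-unique : ∀ {d a b b′} → IsTunnel d (a , b) → IsTunnel d (a , b′) → b ≡ b′
tunnel-unique {b = b} {b′} (a<b , _ , ab , _ , ends) (a<b′ , _ , ab′ , _ , ends′) with ≤-total b b′
... | inj₁ b≤b′ with ends′ b (<⇒≤ a<b) b≤b′ (sym ab)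
...   | inj₁ b≡a  = ⊥-elim (<-irrefl (sym b≡a) a<b)
...   | inj₂ b≡b′ = b≡b′
tunnel-unique {b = b} {b′} (a<b , _ , ab , _ , ends) (a<b′ , _ , ab′ , _ , ends′) | inj₂ b′≤b
  with ends b′ (<⇒≤ a<b′) b′≤b (sym ab′)
...   | inj₁ b′≡a = ⊥-elim (<-irrefl (sym b′≡a) a<b′)
...   | inj₂ b′≡b = sym b′≡b

-- Runs of a word avoiding the consecutive pattern 123 are short: a single letter,
-- or an increasing pair.
data Short : List ℕ → Set where
  single : ∀ x → Short (x ∷ [])
  pair   : ∀ x y → x < y → Short (x ∷ y ∷ [])

pair-head-≤ : ∀ {h t i} → h < t → i ∈ h ∷ t ∷ [] → h ≤ i
pair-head-≤ h<t (here refl)         = ≤-refl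
pair-head-≤ h<t (there (here refl)) = <⇒≤ h<t

Descent : List ℕ → List ℕ → Set
Descent w w′ = first w′ < lastOf w

ShortRuns : List ℕ → List (List ℕ) → Set
ShortRuns w rs = concat rs ≡ w × All Short rs × Linked Descent rs

no-consecutive-123-tail : ∀ x ys → ¬ ContainsConsec123 (x ∷ ys) → ¬ ContainsConsec123 ys
no-consecutive-123-tail x ys no123 (xs , zs , a , b , c , eq , a<b , b<c) =
  no123 (x ∷ xs , zs , a , b , c , cong (x ∷_) eq , a<b , b<c)

runsFrom-short : ∀ x ys → Unique (x ∷ ys) → ¬ ContainsConsec123 (x ∷ ys) →
  ∃[ r ] ∃[ rs ] runsFrom x ys ≡ (x ∷ r) ∷ rs × ShortRuns (x ∷ ys) (runsFrom x ys)
runsFrom-short x [] _ _ = [] , [] , refl , refl , single x ∷ [] , [-]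
runsFrom-short x (y ∷ zs) (x∉ ∷ uniq) no123 with x <? y
... | yes x<y with runsFrom y zs | runsFrom-short y zs uniq (no-consecutive-123-tail x (y ∷ zs) no123)
...   | .((y ∷ r) ∷ rs) | r , rs , refl , concat≡ , short ∷ shorts , descents =
  y ∷ r , rs , refl , cong (x ∷_) concat≡ , extend short concat≡ ∷ shorts , relink descents
  where
  -- y cannot start an increasing pair, as x y z would be a consecutive 123
  extend : Short (y ∷ r) → concat ((y ∷ r) ∷ rs) ≡ y ∷ zs → Short (x ∷ y ∷ r)
  extend (single .y)     _       = pair x y x<y
  extend (pair .y z y<z) concat≡ =
    ⊥-elim (no123 ([] , concat rs , x , y , z , cong (x ∷_) (sym concat≡) , x<y , y<z))
  relink : Linked Descent ((y ∷ r) ∷ rs) → Linked Descent ((x ∷ y ∷ r) ∷ rs)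
  relink [-]             = [-]
  relink (desc ∷ descs) = desc ∷ descs
runsFrom-short x (y ∷ zs) (x∉ ∷ uniq) no123 | no x≮y
  with runsFrom y zs | runsFrom-short y zs uniq (no-consecutive-123-tail x (y ∷ zs) no123)
...   | .((y ∷ r) ∷ rs) | r , rs , refl , concat≡ , shorts , descents =
  [] , (y ∷ r) ∷ rs , refl , cong (x ∷_) concat≡ , single x ∷ shorts , y<x ∷ descents
  where
  y<x : y < x
  y<x = ≤∧≢⇒< (≮⇒≥ x≮y) (λ y≡x → All.head x∉ (sym y≡x))

runs-short : ∀ π → Unique π → ¬ ContainsConsec123 π → ShortRuns π (runs π)
runs-short []       _    _     = refl , [] , []
runs-short (x ∷ xs) uniq no123 = proj₂ (proj₂ (proj₂ (runsFrom-short x xs uniq no123)))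

HeadAbove : List ℕ → List ℕ → Set
HeadAbove w w′ = first w′ < first w

-- After a short run w, a run starting at c < last w starts below the head of w:
-- otherwise head, tail, c would be an occurrence of 132.
next-head-below : ∀ {π w c v} → ¬ Contains132 π → Short w → (w ++ c ∷ v) ⊆ π →
  Unique (w ++ c ∷ v) → c < lastOf w → c < first w
next-head-below _ (single x) _ _ c<x = c<x
next-head-below {c = c} {v} no132 (pair x y _) sub (x∉ ∷ _) c<y with c <? x
... | yes c<x = c<x
... | no  c≮x = ⊥-elim (no132 (x , y , c , ⊆-trans (refl ∷ refl ∷ refl ∷ minimum v) sub ,
                  ≤∧≢⇒< (≮⇒≥ c≮x) (All.lookup x∉ (there (here refl))) , c<y))

heads-decrease : ∀ {π} R → ¬ Contains132 π → concat R ⊆ π → Unique (concat R) →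
  All Short R → Linked Descent R → Linked HeadAbove R
heads-decrease []       _ _ _ _ _ = []
heads-decrease (w ∷ []) _ _ _ _ _ = [-]
heads-decrease (w ∷ [] ∷ R) _ _ _ (_ ∷ () ∷ _) _
heads-decrease (w ∷ (c ∷ v) ∷ R) no132 sub uniq (short ∷ shorts) (desc ∷ descs) =
  next-head-below no132 short sub uniq desc ∷
  heads-decrease ((c ∷ v) ∷ R) no132 (⊆-trans (++⁺ˡ w ⊆-refl) sub) (unique-++ʳ w uniq) shorts descs

stepIn-head : ∀ x y → stepIn (x ∷ y ∷ []) x ≡ U
stepIn-head x y with x ≟ x
... | yes _   = refl
... | no  x≢x = ⊥-elim (x≢x refl)

stepIn-tail : ∀ x y → x < y → stepIn (x ∷ y ∷ []) y ≡ D
stepIn-tail x y x<y with y ≟ x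
... | yes y≡x = ⊥-elim (<-irrefl (sym y≡x) x<y)
... | no  _ with y ≟ y
...   | yes _   = refl
...   | no  y≢y = ⊥-elim (y≢y refl)

tunnelWord-single : ∀ a → tunnelWord (a , suc a) ≡ suc a ∷ []
tunnelWord-single a with suc a ≟ suc a
... | yes _ = refl
... | no  ≢ = ⊥-elim (≢ refl)

tunnelWord-pair : ∀ a y → suc a < y → tunnelWord (a , y) ≡ suc a ∷ y ∷ []
tunnelWord-pair a y a<y with suc a ≟ y
... | yes a≡y = ⊥-elim (<-irrefl a≡y a<y)
... | no  _   = refl

first-tunnelWord : ∀ t → first (tunnelWord t) ≡ suc (proj₁ t)
first-tunnelWord (a , b) with suc a ≟ b
... | yes a≡b = sym a≡b
... | no  _   = refl

tunnelWords-decrease : ∀ {ts : List (ℕ × ℕ)} → Linked (λ s t → proj₁ t < proj₁ s) ts →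
  Linked HeadAbove (map tunnelWord ts)
tunnelWords-decrease = LinkedP.map⁺ ∘ Linked.map (λ {s} {t} t<s →
  subst₂ _<_ (sym (first-tunnelWord t)) (sym (first-tunnelWord s)) (s≤s t<s))

module InClass (n : ℕ) (π : List ℕ) (π∈ : InS132-123 n π) where

  private
    permutation : π ↭ map suc (upTo n)
    permutation = proj₁ π∈
    avoids132 : ¬ Contains132 π
    avoids132 = proj₁ (proj₂ π∈)
    avoids123 : ¬ ContainsConsec123 π
    avoids123 = proj₂ (proj₂ π∈)

  π-unique : Unique π
  π-unique = PermutationS.Unique-resp-↭ (setoid ℕ) (↭⇒↭ₛ (↭-sym permutation))
               (UniqueP.map⁺ suc-injective (UniqueP.upTo⁺ n))

  value∈π : ∀ {i} → 1 ≤ i → i ≤ n → i ∈ π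
  value∈π {suc j} _ j<n = ∈-resp-↭ (↭-sym permutation) (∈-map⁺ suc (∈-upTo⁺ j<n))

  value-range : ∀ {i} → i ∈ π → 1 ≤ i × i ≤ n
  value-range i∈π with ∈-map⁻ suc (∈-resp-↭ permutation i∈π)
  ... | j , j∈ , refl = s≤s z≤n , ∈-upTo⁻ j∈

  R : List (List ℕ)
  R = runs π

  runs-concat : concat R ≡ π
  runs-concat = proj₁ (runs-short π π-unique avoids123)

  runs-are-short : All Short R
  runs-are-short = proj₁ (proj₂ (runs-short π π-unique avoids123))

  R-unique : Unique (concat R)
  R-unique = subst Unique (sym runs-concat) π-unique

  heads-above : Linked HeadAbove R
  heads-above = heads-decrease R avoids132 (subst (_⊆ π) (sym runs-concat) ⊆-refl) R-unique
                  runs-are-short (proj₂ (proj₂ (runs-short π π-unique avoids123)))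

  in-run : ∀ {w i} → w ∈ R → i ∈ w → i ∈ π
  in-run w∈R i∈w = subst (_ ∈_) runs-concat (∈-concat⁺′ i∈w w∈R)

  run-of : ∀ {i} → i ∈ π → ∃[ w ] w ∈ R × i ∈ w
  run-of i∈π with ∈-concat⁻′ R (subst (_ ∈_) (sym runs-concat) i∈π)
  ... | w , i∈w , w∈R = w , w∈R , i∈w

  step : ℕ → Step
  step i = stepIn (runOf R i) i

  stepWord : List Step
  stepWord = map step (interval 1 n)

  Γ-stepWord : proj₁ (Γ π) ≡ stepWord
  Γ-stepWord = cong (map step) (trans (cong (map suc ∘ upTo) length-π) (values-interval n))
    where
    length-π : length π ≡ n
    length-π = trans (↭-length permutation) (trans (cong length (values-interval n)) (length-interval 1 n))

  length-stepWord : length stepWord ≡ n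
  length-stepWord = trans (length-map step (interval 1 n)) (length-interval 1 n)

  step-single : ∀ {x} → (x ∷ []) ∈ R → step x ≡ H
  step-single x∈R rewrite runOf-block R R-unique x∈R (here refl) = refl

  step-head : ∀ {x y} → (x ∷ y ∷ []) ∈ R → step x ≡ U
  step-head {x} {y} xy∈R rewrite runOf-block R R-unique xy∈R (here refl) = stepIn-head x y

  step-tail : ∀ {x y} → (x ∷ y ∷ []) ∈ R → x < y → step y ≡ D
  step-tail {x} {y} xy∈R x<y rewrite runOf-block R R-unique xy∈R (there (here refl)) = stepIn-tail x y x<y

  window : ∀ a L → a + L ≤ n → take L (drop a stepWord) ≡ map step (interval (suc a) L)
  window a L a+L≤n = begin
    take L (drop a (map step (interval 1 n)))  ≡⟨ cong (take L) (drop-map a (interval 1 n)) ⟩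
    take L (map step (drop a (interval 1 n)))  ≡⟨ take-map L (drop a (interval 1 n)) ⟩
    map step (take L (drop a (interval 1 n)))  ≡⟨ cong (map step) (window-interval 1 n a L a+L≤n) ⟩
    map step (interval (suc a) L)              ∎
    where open ≡-Reasoning

  Within : ℕ → ℕ → List ℕ → Set
  Within lo hi w = ∀ {z} → z ∈ w → lo ≤ z × z < hi

  -- A later run would give s t i ≅ 132; an earlier pair
  -- (h, t′) has s < h ≤ i, and t′ > t would give h t′ t ≅ 132.
  nested : ∀ {s t} → (s ∷ t ∷ []) ∈ R → ∀ {i} → s < i → i < t → i ∈ π →
    ∃[ w ] w ∈ R × i ∈ w × Within (suc s) t w
  nested {s} {t} st∈R {i} s<i i<t i∈π with ∈-∃++ st∈R
  ... | As , Bs , R≡ = locate (∈-++⁻ (concat As) (subst (i ∈_) π≡ i∈π))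
    where
    π≡ : π ≡ concat As ++ s ∷ t ∷ concat Bs
    π≡ = trans (sym runs-concat) (trans (cong concat R≡) (sym (concat-++ As _)))
    no132 : ∀ {a b c} → (a ∷ b ∷ c ∷ []) ⊆ concat As ++ s ∷ t ∷ concat Bs → a < c → c < b → ⊥
    no132 {a} {b} {c} sub a<c c<b = avoids132 (a , b , c , subst (_ ⊆_) (sym π≡) sub , a<c , c<b)
    earlier : ∀ {w} → w ∈ As → w ∈ R
    earlier w∈As = subst (_ ∈_) (sym R≡) (∈-++⁺ˡ w∈As)
    inside : ∀ {w} → Short w → w ∈ As → i ∈ w → s < first w → Within (suc s) t w
    inside (single h) _ (here refl) s<h (here refl) = s<h , i<t
    inside (pair h t′ h<t′) w∈As i∈w s<h = λ { (here refl) → s<h , ≤-<-trans h≤i i<t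
                                             ; (there (here refl)) → <-trans s<h h<t′ , t′<t }
      where
      h≤i : h ≤ i
      h≤i = pair-head-≤ h<t′ i∈w
      t′<t : t′ < t
      t′<t with t′ <? t
      ... | yes t′<t = t′<t
      ... | no  t′≮t = ⊥-elim (no132 (block-⊆ w∈As (from∈ (there (here refl)))) (≤-<-trans h≤i i<t)
                         (≤∧≢⇒< (≮⇒≥ t′≮t) (λ t≡t′ → unique-apart (concat As) (subst Unique π≡ π-unique)
                            (∈-concat⁺′ (there (here refl)) w∈As) (there (here refl)) (sym t≡t′))))
    locate : i ∈ concat As ⊎ i ∈ s ∷ t ∷ concat Bs → ∃[ w ] w ∈ R × i ∈ w × Within (suc s) t w
    locate (inj₂ (here refl))           = ⊥-elim (<-irrefl refl s<i)
    locate (inj₂ (there (here refl)))   = ⊥-elim (<-irrefl refl i<t)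
    locate (inj₂ (there (there i∈Bs))) = ⊥-elim (no132 (++⁺ˡ (concat As) (refl ∷ refl ∷ from∈ i∈Bs)) s<i i<t)
    locate (inj₁ i∈As) with ∈-concat⁻′ As i∈As
    ... | w , i∈w , w∈As = w , earlier w∈As , i∈w ,
      inside (All.lookup runs-are-short (earlier w∈As)) w∈As i∈w
        (AllPairs-before As (subst (AllPairs HeadAbove) R≡
          (Linked⇒AllPairs (λ p q → <-trans q p) heads-above)) w∈As)

  Closed : ℕ → ℕ → Set
  Closed lo hi = ∀ {i} → lo ≤ i → i < hi → ∃[ w ] w ∈ R × i ∈ w × Within lo hi w

  closed-single : ∀ {v} → (v ∷ []) ∈ R → Closed v (suc v)
  closed-single {v} v∈R v≤i i≤v =
    v ∷ [] , v∈R , here (≤-antisym (≤-pred i≤v) v≤i) , λ { (here refl) → ≤-refl , ≤-refl }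

  closed-inner : ∀ {s t} → (s ∷ t ∷ []) ∈ R → Closed (suc s) t
  closed-inner {t = t} st∈R s<i i<t =
    nested st∈R s<i i<t (value∈π (≤-trans (s≤s z≤n) s<i) (≤-trans (<⇒≤ i<t) t≤n))
    where
    t≤n : t ≤ n
    t≤n = proj₂ (value-range (in-run st∈R (there (here refl))))

  arc-within : ∀ {s t} → s < t → Within s (suc t) (s ∷ t ∷ [])
  arc-within s<t (here refl)         = ≤-refl , m<n⇒m<1+n s<t
  arc-within s<t (there (here refl)) = <⇒≤ s<t , ≤-refl

  closed-arc : ∀ {s t} → (s ∷ t ∷ []) ∈ R → s < t → Closed s (suc t)
  closed-arc {s} {t} st∈R s<t {i} s≤i i≤t with s ≟ i | i ≟ t
  ... | yes refl | _        = s ∷ t ∷ [] , st∈R , here refl , arc-within s<t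
  ... | no  _    | yes refl = s ∷ t ∷ [] , st∈R , there (here refl) , arc-within s<t
  ... | no  s≢i  | no  i≢t with closed-inner st∈R (≤∧≢⇒< s≤i s≢i) (≤∧≢⇒< (≤-pred i≤t) i≢t)
  ...   | w , w∈R , i∈w , w⊂ = w , w∈R , i∈w , λ z∈w → <⇒≤ (proj₁ (w⊂ z∈w)) , m<n⇒m<1+n (proj₂ (w⊂ z∈w))

  -- Removing a closed initial part [lo, mid) of a closed interval leaves a closed interval:
  -- a run meeting both parts would lie inside [lo, mid).
  closed-tail : ∀ {lo mid hi} → lo ≤ mid → Closed lo hi → Closed lo mid → Closed mid hi
  closed-tail {lo} {mid} lo≤mid closed-hi closed-mid {i} mid≤i i<hi with closed-hi (≤-trans lo≤mid mid≤i) i<hi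
  ... | w , w∈R , i∈w , w⊂ = w , w∈R , i∈w , λ z∈w → above z∈w , proj₂ (w⊂ z∈w)
    where
    above : ∀ {z} → z ∈ w → mid ≤ z
    above {z} z∈w with z <? mid
    ... | no  z≮mid = ≮⇒≥ z≮mid
    ... | yes z<mid with closed-mid (proj₁ (w⊂ z∈w)) z<mid
    ...   | w′ , w′∈R , z∈w′ , w′⊂ =
      ⊥-elim (<⇒≱ (proj₂ (w′⊂ (subst (i ∈_) (same-block R R-unique w∈R w′∈R z∈w z∈w′) i∈w))) mid≤i)

  BalancedOn : ℕ → Set
  BalancedOn k = ∀ {lo} → Closed lo (lo + k) → Balanced (map step (interval lo k))

  balanced-flat : ∀ {lo k} → (lo ∷ []) ∈ R → Closed lo (lo + suc k) → BalancedOn k →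
    Balanced (map step (interval lo (suc k)))
  balanced-flat {lo} {k} lo∈R closed rec rewrite step-single lo∈R =
    flat (rec (subst (Closed (suc lo)) (+-suc lo k) (closed-tail (n≤1+n lo) closed (closed-single lo∈R))))

  balanced-arch : ∀ {lo y k} → (lo ∷ y ∷ []) ∈ R → lo < y → y < lo + suc k → Closed lo (lo + suc k) →
    (∀ {j} → j < suc k → BalancedOn j) → Balanced (map step (interval lo (suc k)))
  balanced-arch {lo} {y} {k} arc lo<y y<end closed rec with m≤n⇒∃[o]m+o≡n lo<y | m≤n⇒∃[o]m+o≡n y<end
  ... | m , refl | r , end≡ = subst (λ K → Balanced (map step (interval lo (suc K)))) (sym k≡) arch-word
    where
    k≡ : k ≡ m + suc r
    k≡ = arc-length lo m r k end≡
    inside : Balanced (map step (interval (suc lo) m))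
    inside = rec (s≤s (subst (m ≤_) (sym k≡) (m≤m+n m (suc r)))) (closed-inner arc)
    beyond : Balanced (map step (interval (suc (suc lo + m)) r))
    beyond = rec (s≤s (subst (r ≤_) (sym k≡) (≤-trans (n≤1+n r) (m≤n+m (suc r) m))))
               (subst (Closed _) (sym end≡) (closed-tail (<⇒≤ (m<n⇒m<1+n lo<y)) closed (closed-arc arc lo<y)))
    arch-word : Balanced (map step (interval lo (suc (m + suc r))))
    arch-word rewrite interval-++ (suc lo) m (suc r) | map-++ step (interval (suc lo) m) (interval (suc lo + m) (suc r))
                    | step-head arc | step-tail arc lo<y = arch inside beyond

  -- By strong induction on the length, through the run of the least value.
  balanced-closed : ∀ k → BalancedOn k
  balanced-closed = <-rec BalancedOn balanced-step
    where
    balanced-step : ∀ k → (∀ {j} → j < k → BalancedOn j) → BalancedOn k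
    balanced-step zero    _   _ = nil
    balanced-step (suc k) rec {lo} closed with closed ≤-refl (m<m+n lo (s≤s z≤n))
    ... | w , w∈R , lo∈w , w⊂ with All.lookup runs-are-short w∈R | lo∈w
    ...   | single _       | here refl         = balanced-flat w∈R closed (rec ≤-refl)
    ...   | pair _ y lo<y  | here refl         = balanced-arch w∈R lo<y (proj₂ (w⊂ (there (here refl)))) closed rec
    ...   | pair x _ x<lo  | there (here refl) = ⊥-elim (<⇒≱ x<lo (proj₁ (w⊂ (here refl))))

  single-tunnel : ∀ {a} → (suc a ∷ []) ∈ R → IsTunnel stepWord (a , suc a)
  single-tunnel {a} a∈R = subst (λ b → IsTunnel stepWord (a , b)) (+-comm a 1)
    (excursion⇒tunnel stepWord a 1 (s≤s z≤n) (subst (a + 1 ≤_) (sym length-stepWord) bound)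
      (subst Excursion (sym (window a 1 bound))
        (subst (λ s → Excursion (s ∷ [])) (sym (step-single a∈R)) excursion-flat)))
    where
    bound : a + 1 ≤ n
    bound = subst (_≤ n) (+-comm 1 a) (proj₂ (value-range (in-run a∈R (here refl))))

  -- A run (a+1, y) spans the tunnel (a, y): its steps read U, a balanced word, D.
  pair-tunnel : ∀ {a y} → (suc a ∷ y ∷ []) ∈ R → suc a < y → IsTunnel stepWord (a , y)
  pair-tunnel {a} {y} arc a<y with m≤n⇒∃[o]m+o≡n a<y
  ... | m , refl = subst (λ b → IsTunnel stepWord (a , b)) (arc-end a m)
      (excursion⇒tunnel stepWord a (suc (m + 1)) (s≤s z≤n) (subst (a + suc (m + 1) ≤_) (sym length-stepWord) bound)
        (subst Excursion (sym (trans (window a (suc (m + 1)) bound) steps))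
          (excursion-arch (balanced-closed m (closed-inner arc)))))
    where
    bound : a + suc (m + 1) ≤ n
    bound = subst (_≤ n) (sym (arc-end a m)) (proj₂ (value-range (in-run arc (there (here refl)))))
    steps : map step (interval (suc a) (suc (m + 1))) ≡ U ∷ map step (interval (suc (suc a)) m) ++ D ∷ []
    steps = begin
      map step (interval (suc a) (suc (m + 1)))
        ≡⟨ cong (λ is → step (suc a) ∷ map step is) (interval-++ (suc (suc a)) m 1) ⟩
      step (suc a) ∷ map step (interval (suc (suc a)) m ++ interval (suc (suc a) + m) 1)
        ≡⟨ cong (step (suc a) ∷_) (map-++ step (interval (suc (suc a)) m) _) ⟩
      step (suc a) ∷ map step (interval (suc (suc a)) m) ++ step (suc (suc a) + m) ∷ []
        ≡⟨ cong₂ (λ u v → u ∷ map step (interval (suc (suc a)) m) ++ v ∷ []) (step-head arc) (step-tail arc a<y) ⟩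
      U ∷ map step (interval (suc (suc a)) m) ++ D ∷ []  ∎
      where open ≡-Reasoning

  run⇒tunnel : ∀ {w} → w ∈ R → ∃[ t ] IsTunnel stepWord t × tunnelWord t ≡ w
  run⇒tunnel w∈R with All.lookup runs-are-short w∈R | w∈R
  ... | single zero        | w∈R′ = contradiction (proj₁ (value-range (in-run w∈R′ (here refl)))) λ ()
  ... | single (suc a)     | w∈R′ = (a , suc a) , single-tunnel w∈R′ , tunnelWord-single a
  ... | pair zero _ _      | w∈R′ = contradiction (proj₁ (value-range (in-run w∈R′ (here refl)))) λ ()
  ... | pair (suc a) y a<y | w∈R′ = (a , y) , pair-tunnel w∈R′ a<y , tunnelWord-pair a y a<y

  -- Conversely, the tunnel starting at a is the tunnel of the run containing a + 1,
  -- since tunnels are determined by their left endpoint.  The letter a + 1 cannot be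
  -- the tail of a run: the path would step down right after a, below the tunnel.
  tunnel⇒run : ∀ {t} → IsTunnel stepWord t → tunnelWord t ∈ R
  tunnel⇒run {a , b} tunnel@(a<b , b≤ , _ , weakly-above , _)
    with run-of (value∈π (s≤s z≤n) (≤-trans a<b (subst (b ≤_) length-stepWord b≤)))
  ... | w , w∈R , a∈w with All.lookup runs-are-short w∈R | w∈R | a∈w
  ...   | single _     | w∈R′ | here refl
    rewrite tunnel-unique tunnel (single-tunnel w∈R′) | tunnelWord-single a = w∈R′
  ...   | pair _ y a<y | w∈R′ | here refl
    rewrite tunnel-unique tunnel (pair-tunnel w∈R′ a<y) | tunnelWord-pair a y a<y = w∈R′
  ...   | pair x _ x<a | w∈R′ | there (here refl) = ⊥-elim (ℤP.≤⇒≯ stays-above (falls (height stepWord a)))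
    where
    bound : a + 1 ≤ n
    bound = subst (_≤ n) (+-comm 1 a) (proj₂ (value-range (in-run w∈R′ (there (here refl)))))
    steps-down : height stepWord (a + 1) ≡ height stepWord a ℤ.+ -[1+ 0 ]
    steps-down rewrite height-window stepWord a 1 | window a 1 bound | step-tail w∈R′ x<a = refl
    stays-above : height stepWord a ℤ.≤ height stepWord a ℤ.+ -[1+ 0 ]
    stays-above = subst (height stepWord a ℤ.≤_) steps-down
                    (weakly-above (a + 1) (m≤m+n a 1) (subst (_≤ b) (+-comm 1 a) a<b))

-- Runs and tunnel words both have strictly decreasing first letters, and a word is a
-- run exactly when it is the word of a tunnel of d = stepWord; so the lists coincide.
proposition5p1 : (n : ℕ) (d : List Step) (π : List ℕ) (ts : List (ℕ × ℕ)) →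
    IsMotzkin n d → InS132-123 n π → Γ π ≡ (d , replicate n 0) →
    TunnelsDecreasing d ts →
    runs π ≡ map tunnelWord ts
proposition5p1 n d π ts _ π∈ Γπ≡ (ts-tunnels , ts-decrease) =
  decreasing-unique first heads-above (tunnelWords-decrease ts-decrease) run⇒listed listed⇒run
  where
  open InClass n π π∈
  d≡ : d ≡ stepWord
  d≡ = trans (sym (cong proj₁ Γπ≡)) Γ-stepWord
  run⇒listed : ∀ {w} → w ∈ runs π → w ∈ map tunnelWord ts
  run⇒listed w∈R with run⇒tunnel w∈R
  ... | t , tunnel , refl =
    ∈-map⁺ tunnelWord (Equivalence.from (ts-tunnels t) (subst (λ e → IsTunnel e t) (sym d≡) tunnel))
  listed⇒run : ∀ {w} → w ∈ map tunnelWord ts → w ∈ runs π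
  listed⇒run w∈ts with ∈-map⁻ tunnelWord w∈ts
  ... | t , t∈ts , refl = tunnel⇒run (subst (λ e → IsTunnel e t) d≡ (Equivalence.to (ts-tunnels t) t∈ts))
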